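{- Let $n,a,k\in\mathbb{N}$. Then: (1) if ${}^{k} a\equiv {}^{k-1} a \pmod n$, then $\operatorname{ord}_n^{(k)}(a)=1$; (2) $\operatorname{lev}_n(a)\geq \min\{\nu\in\mathbb{N}_0: \operatorname{ord}_n^{(\nu)}(a)=1\}-1$.
   Context: Tetration: ${}^0a=1$, ${}^ka=a^{({}^{k-1}a)}$. For $n,a\in\mathbb{N}$, $\operatorname{lev}_n(a)$ (the level of $a$ modulo $n$) is the length of the preperiod of the eventually constant sequence $({}^ka\bmod n)_{k\ge0}$, i.e. the least $t\ge0$ with ${}^ka\equiv{}^ta\pmod n$ for all $k\ge t$. $V(a,n)$ is the largest divisor of $n$ coprime to $a$. Iterated orders: $\operatorname{ord}_n^{(0)}(a)=n$ and $\operatorname{ord}_n^{(k)}(a)=\operatorname{ord}_{V(a,\operatorname{ord}_n^{(k-1)}(a))}(a)$ for $k\in\mathbb{N}$, where $\operatorname{ord}_m(a)$ is the multiplicative order of $a$ modulo $m$ (with $\operatorname{ord}_1(a)=1$). -}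

module Defs where

open import Data.Nat using (ℕ; zero; suc; _+_; _∸_; _^_; _≤_; _<_; _≡ᵇ_)
open import Data.Nat.DivMod using (_%_)
open import Data.Nat.GCD using (gcd)
open import Data.Nat.Divisibility using (_∣?_)
open import Data.Bool using (Bool; true; false; if_then_else_; _∧_)
open import Relation.Nullary.Decidable using (⌊_⌋)
open import Relation.Binary.PropositionalEquality using (_≡_)

tet : ℕ → ℕ → ℕ
tet a zero    = 1
tet a (suc k) = a ^ tet a k

-- Reduction modulo m (convention: x mod 0 = x; only m ≥ 1 is ever used)
modN : ℕ → ℕ → ℕ
modN x zero    = x
modN x (suc m) = x % suc m

findDown : (ℕ → Bool) → ℕ → ℕ
findDown p zero    = 0
findDown p (suc k) = if p (suc k) then suc k else findDown p k

findUp : (ℕ → Bool) → ℕ → ℕ → ℕ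
findUp p s zero    = 0
findUp p s (suc c) = if p s then s else findUp p (suc s) c

V : ℕ → ℕ → ℕ
V a n = findDown (λ d → ⌊ d ∣? n ⌋ ∧ (gcd d a ≡ᵇ 1)) n

-- ord_m(a): least d ≥ 1 with a^d ≡ 1 (mod m). For gcd(a,m)=1, m ≥ 1,
-- this d satisfies d ≤ φ(m) ≤ m, so searching d ∈ {1,…,m} is exact.
-- (ord_1(a) = 1.)
ord : ℕ → ℕ → ℕ
ord m a = findUp (λ d → modN (a ^ d) m ≡ᵇ modN 1 m) 1 m

iterOrd : ℕ → ℕ → ℕ → ℕ
iterOrd n a zero    = n
iterOrd n a (suc k) = ord (V a (iterOrd n a k)) a

IsLevel : ℕ → ℕ → ℕ → Set
IsLevel n a t =
  (∀ k → t ≤ k → modN (tet a k) n ≡ modN (tet a t) n) ×'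
  (∀ s → s < t → ¬' (∀ k → s ≤ k → modN (tet a k) n ≡ modN (tet a s) n))
  where
    open import Data.Product using () renaming (_×_ to _×'_)
    open import Relation.Nullary using () renaming (¬_ to ¬'_)

IsLeastOrdOne : ℕ → ℕ → ℕ → Set
IsLeastOrdOne n a ν = (iterOrd n a ν ≡ 1) ×' (∀ μ → μ < ν → ¬' (iterOrd n a μ ≡ 1))
  where
    open import Data.Product using () renaming (_×_ to _×'_)
    open import Relation.Nullary using () renaming (¬_ to ¬'_)

{-# OPTIONS --safe #-}
module Submission where

-- With v = V(a,n), a is a unit modulo v, so a^x ≡ a^y (mod n) forces x ≡ y modulo
-- ord_v(a) = ord⁽¹⁾_n(a). As ᵏ⁺¹a = a^(ᵏa) and ⁰a = 1 = a⁰, a coincidence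
-- ᵏ⁺¹a ≡ ᵏa (mod n) therefore descends to ᵏa ≡ ᵏ⁻¹a (mod ord⁽¹⁾_n(a)), and after k
-- descents to a ≡ a⁰ (mod ord⁽ᵏ⁾_n(a)); one more gives 1 ≡ 0 (mod ord⁽ᵏ⁺¹⁾_n(a)),
-- i.e. ord⁽ᵏ⁺¹⁾_n(a) = 1. The level t has ᵗ⁺¹a ≡ ᵗa (mod n), which bounds ν by t + 1.

open import Data.Bool using (Bool; true; false; T; _∧_)
open import Data.Bool.Properties using (T-∧)
open import Data.Empty using (⊥-elim)
open import Data.Fin using (toℕ; fromℕ<)
open import Data.Fin.Properties using (pigeonhole; toℕ≤pred[n]; toℕ-fromℕ<)
open import Data.Nat
open import Data.Nat.GCD using (gcd)
open import Data.Nat.Coprimality using (Coprime; coprime-divisor; coprime⇒gcd≡1; gcd≡1⇒coprime; 1-coprimeTo)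
open import Data.Nat.DivMod hiding (_mod_)
open import Data.Nat.Divisibility
open import Data.Nat.Properties
open import Data.Product using (∃-syntax; _×_; _,_; proj₁; proj₂)
open import Data.Sum using (inj₁; inj₂)
open import Function.Bundles using (Equivalence)
open import Relation.Binary.PropositionalEquality
open import Relation.Nullary using (¬_; contradiction; yes; no)
open import Relation.Nullary.Decidable using (⌊_⌋; fromWitness; toWitness)

open import Defs

private variable
  a c d e i j x x′ y y′ : ℕ

infix 4 _≡_mod_
_≡_mod_ : ℕ → ℕ → (n : ℕ) → .{{NonZero n}} → Set
x ≡ y mod n = x % n ≡ y % n

module _ {n : ℕ} .{{_ : NonZero n}} where
  open ≡-Reasoning

  *-cong-mod : x ≡ x′ mod n → y ≡ y′ mod n → x * y ≡ x′ * y′ mod n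
  *-cong-mod {x} {x′} {y} {y′} x≡x′ y≡y′ = begin
    (x * y) % n                 ≡⟨ %-distribˡ-* x y n ⟩
    ((x % n) * (y % n)) % n     ≡⟨ cong₂ (λ u v → (u * v) % n) x≡x′ y≡y′ ⟩
    ((x′ % n) * (y′ % n)) % n   ≡⟨ %-distribˡ-* x′ y′ n ⟨
    (x′ * y′) % n               ∎

  ^-congˡ-mod : ∀ e → x ≡ x′ mod n → x ^ e ≡ x′ ^ e mod n
  ^-congˡ-mod zero    _    = refl
  ^-congˡ-mod (suc e) x≡x′ = *-cong-mod x≡x′ (^-congˡ-mod e x≡x′)

  ≡-mod⇒∣∸ : x ≤ y → x ≡ y mod n → n ∣ y ∸ x
  ≡-mod⇒∣∸ {x} {y} _ x≡y = divides (y / n ∸ x / n) (begin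
    y ∸ x                                         ≡⟨ cong₂ _∸_ (m≡m%n+[m/n]*n y n) (m≡m%n+[m/n]*n x n) ⟩
    (y % n + y / n * n) ∸ (x % n + x / n * n)     ≡⟨ cong (λ r → (y % n + y / n * n) ∸ (r + x / n * n)) x≡y ⟩
    (y % n + y / n * n) ∸ (y % n + x / n * n)     ≡⟨ [m+n]∸[m+o]≡n∸o (y % n) _ _ ⟩
    y / n * n ∸ x / n * n                         ≡⟨ *-distribʳ-∸ n (y / n) (x / n) ⟨
    (y / n ∸ x / n) * n                           ∎)

  ∣∸⇒≡-mod : x ≤ y → n ∣ y ∸ x → x ≡ y mod n
  ∣∸⇒≡-mod {x} {y} x≤y n∣y∸x = begin
    x % n             ≡⟨ %-remove-+ʳ x n∣y∸x ⟨
    (x + (y ∸ x)) % n ≡⟨ cong (_% n) (m+[n∸m]≡n x≤y) ⟩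
    y % n             ∎

  private
    *-cancelˡ-mod-≤ : Coprime n c → x ≤ y → c * x ≡ c * y mod n → x ≡ y mod n
    *-cancelˡ-mod-≤ {c} {x} {y} n⊥c x≤y cx≡cy = ∣∸⇒≡-mod x≤y (coprime-divisor n⊥c
      (subst (n ∣_) (sym (*-distribˡ-∸ c y x)) (≡-mod⇒∣∸ (*-monoʳ-≤ c x≤y) cx≡cy)))

  *-cancelˡ-mod : Coprime n c → c * x ≡ c * y mod n → x ≡ y mod n
  *-cancelˡ-mod {x = x} {y} n⊥c cx≡cy with ≤-total x y
  ... | inj₁ x≤y = *-cancelˡ-mod-≤ n⊥c x≤y cx≡cy
  ... | inj₂ y≤x = sym (*-cancelˡ-mod-≤ n⊥c y≤x (sym cx≡cy))

  ^*-cancelˡ-mod : Coprime n a → ∀ i → a ^ i * x ≡ a ^ i * y mod n → x ≡ y mod n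
  ^*-cancelˡ-mod {x = x} {y} n⊥a zero eq =
    subst₂ (λ u v → u ≡ v mod n) (*-identityˡ x) (*-identityˡ y) eq
  ^*-cancelˡ-mod {a} {x} {y} n⊥a (suc i) eq = ^*-cancelˡ-mod n⊥a i (*-cancelˡ-mod n⊥a
    (subst₂ (λ u v → u ≡ v mod n) (*-assoc a (a ^ i) x) (*-assoc a (a ^ i) y) eq))

  ^≡^⇒^∸≡1 : Coprime n a → i ≤ j → a ^ i ≡ a ^ j mod n → a ^ (j ∸ i) ≡ 1 mod n
  ^≡^⇒^∸≡1 {a} {i} {j} n⊥a i≤j a^i≡a^j = sym (^*-cancelˡ-mod n⊥a i
    (subst₂ (λ u v → u ≡ v mod n) (sym (*-identityʳ (a ^ i))) a^j≡a^i*a^[j∸i] a^i≡a^j))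
    where
    a^j≡a^i*a^[j∸i] : a ^ j ≡ a ^ i * a ^ (j ∸ i)
    a^j≡a^i*a^[j∸i] = trans (cong (a ^_) (sym (m+[n∸m]≡n i≤j))) (^-distribˡ-+-* a i (j ∸ i))

  ∣-resp-≡-mod : d ∣ n → .{{_ : NonZero d}} → x ≡ y mod n → x ≡ y mod d
  ∣-resp-≡-mod {d} {x} {y} d∣n x≡y = begin
    x % d       ≡⟨ m∣n⇒o%n%m≡o%m d n x d∣n ⟨
    x % n % d   ≡⟨ cong (_% d) x≡y ⟩
    y % n % d   ≡⟨ m∣n⇒o%n%m≡o%m d n y d∣n ⟩
    y % d       ∎

-- Positivity of the order d is carried separately, by a NonZero instance.
record IsOrder (n a d : ℕ) .{{_ : NonZero n}} : Set where
  field
    ^-order : a ^ d ≡ 1 mod n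
    minimal : 0 < e → e < d → ¬ (a ^ e ≡ 1 mod n)

module _ {n a : ℕ} .{{_ : NonZero n}} (n⊥a : Coprime n a) where

  order-exists : ∃[ e ] 0 < e × e ≤ n × a ^ e ≡ 1 mod n
  order-exists with pigeonhole (n<1+n n) (λ i → fromℕ< (m%n<n (a ^ toℕ i) n))
  ... | i , j , i<j , fi≡fj =
    toℕ j ∸ toℕ i , m<n⇒0<n∸m i<j , ≤-trans (m∸n≤m (toℕ j) (toℕ i)) (toℕ≤pred[n] j) ,
    ^≡^⇒^∸≡1 n⊥a (<⇒≤ i<j) (trans (sym (toℕ-fromℕ< _)) (trans (cong toℕ fi≡fj) (toℕ-fromℕ< _)))

  module _ {d : ℕ} .{{_ : NonZero d}} (order : IsOrder n a d) where
    open IsOrder order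
    open ≡-Reasoning

    ^-%-order : ∀ x → a ^ x ≡ a ^ (x % d) mod n
    ^-%-order x = begin
      a ^ x % n                           ≡⟨ cong (λ r → a ^ r % n) (m≡m%n+[m/n]*n x d) ⟩
      a ^ (x % d + x / d * d) % n         ≡⟨ cong (_% n) (^-distribˡ-+-* a (x % d) (x / d * d)) ⟩
      a ^ (x % d) * a ^ (x / d * d) % n   ≡⟨ *-cong-mod {x = a ^ (x % d)} refl a^[qd]≡1 ⟩
      a ^ (x % d) * 1 % n                 ≡⟨ cong (_% n) (*-identityʳ _) ⟩
      a ^ (x % d) % n                     ∎
      where
      a^[qd]≡1 : a ^ (x / d * d) ≡ 1 mod n
      a^[qd]≡1 = begin
        a ^ (x / d * d) % n     ≡⟨ cong (λ r → a ^ r % n) (*-comm (x / d) d) ⟩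
        a ^ (d * (x / d)) % n   ≡⟨ cong (_% n) (^-*-assoc a d (x / d)) ⟨
        (a ^ d) ^ (x / d) % n   ≡⟨ ^-congˡ-mod (x / d) ^-order ⟩
        1 ^ (x / d) % n         ≡⟨ cong (_% n) (^-zeroˡ (x / d)) ⟩
        1 % n                   ∎

    ^-injective-below-order : i ≤ j → j < d → a ^ i ≡ a ^ j mod n → i ≡ j
    ^-injective-below-order {i} {j} i≤j j<d a^i≡a^j with m≤n⇒m<n∨m≡n i≤j
    ... | inj₂ i≡j = i≡j
    ... | inj₁ i<j = contradiction (^≡^⇒^∸≡1 n⊥a i≤j a^i≡a^j)
                       (minimal (m<n⇒0<n∸m i<j) (≤-<-trans (m∸n≤m j i) j<d))

    ^-%-order-cong : ∀ x y → a ^ x ≡ a ^ y mod n → a ^ (x % d) ≡ a ^ (y % d) mod n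
    ^-%-order-cong x y eq = trans (sym (^-%-order x)) (trans eq (^-%-order y))

    ^-injective-mod-order : ∀ x y → a ^ x ≡ a ^ y mod n → x ≡ y mod d
    ^-injective-mod-order x y a^x≡a^y with ≤-total (x % d) (y % d)
    ... | inj₁ x%d≤y%d =
      ^-injective-below-order x%d≤y%d (m%n<n y d) (^-%-order-cong x y a^x≡a^y)
    ... | inj₂ y%d≤x%d =
      sym (^-injective-below-order y%d≤x%d (m%n<n x d) (^-%-order-cong y x (sym a^x≡a^y)))

findUp-least : ∀ (p : ℕ → Bool) s c → s ≤ d → d < s + c → T (p d) →
  s ≤ findUp p s c × T (p (findUp p s c)) × (∀ {e} → s ≤ e → e < findUp p s c → ¬ T (p e))
findUp-least {d} p s zero s≤d d<s+0 _ =
  contradiction s≤d (<⇒≱ (subst (d <_) (+-identityʳ s) d<s+0))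
findUp-least {d} p s (suc c) s≤d d<s+1+c pd with p s in ps
... | true = ≤-refl , subst T (sym ps) _ , λ s≤e e<s → contradiction s≤e (<⇒≱ e<s)
... | false with m≤n⇒m<n∨m≡n s≤d
...   | inj₂ refl = ⊥-elim (subst T ps pd)
...   | inj₁ s<d with findUp-least p (suc s) c s<d (subst (d <_) (+-suc s c) d<s+1+c) pd
...     | s<r , pr , below = <⇒≤ s<r , pr , below′
  where
  below′ : s ≤ e → e < findUp p (suc s) c → ¬ T (p e)
  below′ s≤e e<r with m≤n⇒m<n∨m≡n s≤e
  ... | inj₁ s<e  = below s<e e<r
  ... | inj₂ refl = subst T ps

findDown-sound : ∀ (p : ℕ → Bool) k → T (p 1) → T (p (findDown p (suc k)))
findDown-sound p zero p1 with p 1 in eq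
... | true  = subst T (sym eq) _
... | false = ⊥-elim p1
findDown-sound p (suc k) p1 with p (suc (suc k)) in eq
... | true  = subst T (sym eq) _
... | false = findDown-sound p k p1

ord-isOrder : ∀ {n a} .{{_ : NonZero n}} → Coprime n a → 0 < ord n a × IsOrder n a (ord n a)
ord-isOrder {suc m} {a} n⊥a with order-exists n⊥a
... | e , 0<e , e≤n , a^e≡1
  with findUp-least (λ d → modN (a ^ d) (suc m) ≡ᵇ modN 1 (suc m)) 1 (suc m)
         0<e (s≤s e≤n) (≡⇒≡ᵇ _ _ a^e≡1)
... | 0<r , pr , below =
  0<r , record { ^-order = ≡ᵇ⇒≡ _ _ pr ; minimal = λ 0<e e<r eq → below 0<e e<r (≡⇒≡ᵇ _ _ eq) }

V-spec : ∀ a n .{{_ : NonZero n}} → V a n ∣ n × Coprime (V a n) a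
V-spec a n@(suc m) = toWitness (proj₁ sound) , gcd≡1⇒coprime (≡ᵇ⇒≡ _ _ (proj₂ sound))
  where
  sound : T ⌊ V a n ∣? n ⌋ × T (gcd (V a n) a ≡ᵇ 1)
  sound = Equivalence.to T-∧ (findDown-sound (λ d → ⌊ d ∣? n ⌋ ∧ (gcd d a ≡ᵇ 1)) m
    (Equivalence.from T-∧ (fromWitness (1∣ n) , ≡⇒≡ᵇ _ _ (coprime⇒gcd≡1 (1-coprimeTo a)))))

-- V and ord are stuck on a variable modulus, so instance search cannot settle these
-- NonZero goals; the instances are passed explicitly.
V-nonZero : ∀ a n .{{_ : NonZero n}} → NonZero (V a n)
V-nonZero a n =
  ≢-nonZero λ V≡0 → ≢-nonZero⁻¹ n (0∣⇒≡0 (subst (_∣ n) V≡0 (proj₁ (V-spec a n))))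

ordV-nonZero : ∀ a n .{{_ : NonZero n}} → NonZero (ord (V a n) a)
ordV-nonZero a n = >-nonZero (proj₁ (ord-isOrder {{V-nonZero a n}} (proj₂ (V-spec a n))))

^-≡-mod⇒≡-mod-ordV : ∀ {n} .{{_ : NonZero n}} a x y →
  a ^ x ≡ a ^ y mod n → _≡_mod_ x y (ord (V a n) a) {{ordV-nonZero a n}}
^-≡-mod⇒≡-mod-ordV {n} a x y a^x≡a^y =
  ^-injective-mod-order {{V-nonZero a n}} V⊥a {{ordV-nonZero a n}}
    (proj₂ (ord-isOrder {{V-nonZero a n}} V⊥a)) x y
    (∣-resp-≡-mod (proj₁ (V-spec a n)) {{V-nonZero a n}} a^x≡a^y)
  where
  V⊥a : Coprime (V a n) a
  V⊥a = proj₂ (V-spec a n)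

iterOrd-shift : ∀ n a k → iterOrd n a (suc k) ≡ iterOrd (ord (V a n) a) a k
iterOrd-shift n a zero    = refl
iterOrd-shift n a (suc k) = cong (λ m → ord (V a m) a) (iterOrd-shift n a k)

1≡0-mod⇒≡1 : ∀ n .{{_ : NonZero n}} → 1 ≡ 0 mod n → n ≡ 1
1≡0-mod⇒≡1 1             _  = refl
1≡0-mod⇒≡1 (suc (suc _)) ()

tet-stable⇒iterOrd≡1 : ∀ {n} .{{_ : NonZero n}} a k →
  tet a (suc k) ≡ tet a k mod n → iterOrd n a (suc k) ≡ 1
tet-stable⇒iterOrd≡1 {n} a zero eq =
  1≡0-mod⇒≡1 _ {{ordV-nonZero a n}} (^-≡-mod⇒≡-mod-ordV a 1 0 eq)
tet-stable⇒iterOrd≡1 {n} a (suc k) eq = begin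
  iterOrd n a (suc (suc k))           ≡⟨ iterOrd-shift n a (suc k) ⟩
  iterOrd (ord (V a n) a) a (suc k)   ≡⟨ descend ⟩
  1                                   ∎
  where
  open ≡-Reasoning
  descend : iterOrd (ord (V a n) a) a (suc k) ≡ 1
  descend = tet-stable⇒iterOrd≡1 {{ordV-nonZero a n}} a k (^-≡-mod⇒≡-mod-ordV a _ _ eq)

lemma5p3 : (n a : ℕ) → 1 ≤ n → 1 ≤ a →
    ((k : ℕ) → 1 ≤ k →
      modN (tet a k) n ≡ modN (tet a (k ∸ 1)) n → iterOrd n a k ≡ 1)
    ×
    ((t : ℕ) → IsLevel n a t → (ν : ℕ) → IsLeastOrdOne n a ν → ν ∸ 1 ≤ t)
lemma5p3 (suc n) a _ _ = stable⇒iterOrd≡1 , level-bound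
  where
  stable⇒iterOrd≡1 : (k : ℕ) → 1 ≤ k →
    modN (tet a k) (suc n) ≡ modN (tet a (k ∸ 1)) (suc n) → iterOrd (suc n) a k ≡ 1
  stable⇒iterOrd≡1 (suc k) _ = tet-stable⇒iterOrd≡1 a k

  level-bound : (t : ℕ) → IsLevel (suc n) a t → (ν : ℕ) → IsLeastOrdOne (suc n) a ν → ν ∸ 1 ≤ t
  level-bound t (stable , _) ν (_ , minimal) with ν ≤? suc t
  ... | yes ν≤1+t = ∸-monoˡ-≤ 1 ν≤1+t
  ... | no  ν≰1+t = contradiction (tet-stable⇒iterOrd≡1 a t (stable (suc t) (n≤1+n t)))
                                  (minimal (suc t) (≰⇒> ν≰1+t))
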